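{- Let $w,v\in\Sigma^\ast$ with $\mathrm{alph}(w)=\mathrm{alph}(v)$, let $a,b\in\Sigma$ with $\pi_{a,b}(w)=\pi_{a,b}(v)$, and suppose $w=x\,a\,b\,y$ for some $x,y\in\Sigma^\ast$. Let $w'=x\,b\,a\,y$. Then $E(G(w,v))\setminus\{\{a,b\}\}=E(G(w',v))$.
   Context: $\Sigma$ is a finite alphabet; $\mathrm{alph}(w)$ is the set of letters occurring in $w$. For letters $a,b$, $\pi_{a,b}$ is the monoid morphism on $\Sigma^\ast$ with $a\mapsto a$, $b\mapsto b$ and all other letters mapped to the empty word. For words $w,v$ with $\mathrm{alph}(w)=\mathrm{alph}(v)=A$, $G(w,v)$ is the undirected simple graph on vertex set $A$ in which distinct $c,d$ are adjacent iff $\pi_{c,d}(w)=\pi_{c,d}(v)$; $E(\cdot)$ denotes the edge set. -}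

module Defs where

open import Data.Nat using (ℕ)
open import Data.Fin using (Fin; _≟_)
open import Data.List using (List; filter)
open import Data.List.Membership.Propositional using (_∈_)
open import Data.Product using (_×_)
open import Data.Sum using (_⊎_)
open import Relation.Nullary using (¬_)
open import Relation.Nullary.Decidable using (_⊎-dec_)
open import Relation.Binary.PropositionalEquality using (_≡_; _≢_)
open import Function.Bundles using (_⇔_)

Word : ℕ → Set
Word n = List (Fin n)

π : ∀ {n} → Fin n → Fin n → Word n → Word n
π a b = filter (λ x → (x ≟ a) ⊎-dec (x ≟ b))

SameAlph : ∀ {n} → Word n → Word n → Set
SameAlph w v = ∀ c → (c ∈ w) ⇔ (c ∈ v)

-- {c,d} is an edge of G(w,v) (vertex set alph(w)).
IsEdge : ∀ {n} → Word n → Word n → Fin n → Fin n → Set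
IsEdge w v c d = c ≢ d × c ∈ w × d ∈ w × π c d w ≡ π c d v

SamePair : ∀ {n} → Fin n → Fin n → Fin n → Fin n → Set
SamePair c d a b = (c ≡ a × d ≡ b) ⊎ (c ≡ b × d ≡ a)

{-# OPTIONS --safe #-}
module Submission where

open import Defs
open import Data.Nat using (ℕ)
open import Data.Fin using (Fin; _≟_)
open import Data.List using (List; []; _++_; _∷_; filter)
open import Data.List.Properties using (filter-reject; filter-≐; ∷-injective)
open import Data.List.Membership.Propositional using (_∈_)
open import Data.List.Relation.Binary.Permutation.Propositional using (_↭_; ↭-refl; ↭-swap)
open import Data.List.Relation.Binary.Permutation.Propositional.Properties using (++⁺ˡ; ∈-resp-↭)
open import Data.Product using (_×_; _,_; proj₁; proj₂)
open import Data.Sum using (_⊎_; inj₁; inj₂; swap)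
open import Function.Bundles using (_⇔_; mk⇔)
open import Level using (Level)
open import Relation.Nullary using (¬_; Dec; yes; no; contradiction)
open import Relation.Unary using (Pred; Decidable)
open import Relation.Binary.PropositionalEquality using (_≡_; _≢_; refl; sym; trans; cong; ≢-sym; module ≡-Reasoning)

-- Swapping adjacent letters a ≠ b leaves π_{c,d} unchanged unless both letters
-- lie in {c,d}, i.e. unless {c,d} = {a,b}; and it does change π_{a,b}, where the
-- swapped pair survives the projection. As π_{a,b}(w) = π_{a,b}(v), the pair
-- {a,b} is an edge of G(w,v) but not of G(w′,v), and all other edges agree.

private
  variable
    ℓ p : Level
    A : Set ℓ

++-swap-↭ : ∀ (xs : List A) {u v} ys → xs ++ u ∷ v ∷ ys ↭ xs ++ v ∷ u ∷ ys
++-swap-↭ xs {u} {v} ys = ++⁺ˡ xs (↭-swap u v ↭-refl)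

module _ {P : Pred A p} (P? : Decidable P) where

  filter-∷-cong : ∀ z {xs ys} → filter P? xs ≡ filter P? ys →
    filter P? (z ∷ xs) ≡ filter P? (z ∷ ys)
  filter-∷-cong z eq with P? z
  ... | yes _ = cong (z ∷_) eq
  ... | no _  = eq

  filter-swap-head : ∀ {u v} → ¬ P u ⊎ ¬ P v → ∀ ys →
    filter P? (u ∷ v ∷ ys) ≡ filter P? (v ∷ u ∷ ys)
  filter-swap-head {u} {v} (inj₁ ¬pu) ys =
    trans (filter-reject P? ¬pu) (filter-∷-cong v (sym (filter-reject P? ¬pu)))
  filter-swap-head {u} {v} (inj₂ ¬pv) ys =
    trans (filter-∷-cong u (filter-reject P? ¬pv)) (sym (filter-reject P? ¬pv))

  filter-swap : ∀ {u v} → ¬ (P u × P v) → ∀ xs ys →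
    filter P? (xs ++ u ∷ v ∷ ys) ≡ filter P? (xs ++ v ∷ u ∷ ys)
  filter-swap {u} {v} ¬both [] = filter-swap-head (one-rejected (P? u))
    where
    one-rejected : Dec (P u) → ¬ P u ⊎ ¬ P v
    one-rejected (yes pu) = inj₂ (λ pv → ¬both (pu , pv))
    one-rejected (no ¬pu) = inj₁ ¬pu
  filter-swap ¬both (x ∷ xs) ys = filter-∷-cong x (filter-swap ¬both xs ys)

  filter-swap-injective : ∀ {u v} → P u → P v → ∀ xs ys →
    filter P? (xs ++ u ∷ v ∷ ys) ≡ filter P? (xs ++ v ∷ u ∷ ys) → u ≡ v
  filter-swap-injective {u} {v} pu pv [] ys eq with P? u | P? v
  ... | yes _   | yes _   = proj₁ (∷-injective eq)
  ... | no ¬pu  | _       = contradiction pu ¬pu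
  ... | yes _   | no ¬pv  = contradiction pv ¬pv
  filter-swap-injective pu pv (x ∷ xs) ys eq with P? x
  ... | yes _ = filter-swap-injective pu pv xs ys (proj₂ (∷-injective eq))
  ... | no _  = filter-swap-injective pu pv xs ys eq

module _ {n : ℕ} where

  π-comm : ∀ (c d : Fin n) w → π c d w ≡ π d c w
  π-comm c d = filter-≐ _ _ (swap , swap)

  π-swap : ∀ {a b c d : Fin n} → ¬ SamePair c d a b → ∀ x y →
    π c d (x ++ a ∷ b ∷ y) ≡ π c d (x ++ b ∷ a ∷ y)
  π-swap {a} {b} {c} {d} ¬ab with a ≟ b
  ... | yes refl = λ _ _ → refl
  ... | no a≢b   = filter-swap _ ¬both
    where
    ¬both : ¬ ((a ≡ c ⊎ a ≡ d) × (b ≡ c ⊎ b ≡ d))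
    ¬both (inj₁ refl , inj₁ refl) = a≢b refl
    ¬both (inj₁ refl , inj₂ refl) = ¬ab (inj₁ (refl , refl))
    ¬both (inj₂ refl , inj₁ refl) = ¬ab (inj₂ (refl , refl))
    ¬both (inj₂ refl , inj₂ refl) = a≢b refl

  π-swap-≢ : ∀ {a b : Fin n} → a ≢ b → ∀ x y →
    π a b (x ++ a ∷ b ∷ y) ≢ π a b (x ++ b ∷ a ∷ y)
  π-swap-≢ a≢b x y eq = a≢b (filter-swap-injective _ (inj₁ refl) (inj₂ refl) x y eq)

lemma2 : (n : ℕ) (w v x y : Word n) (a b : Fin n) →
    SameAlph w v → π a b w ≡ π a b v → w ≡ x ++ (a ∷ b ∷ y) →
    ∀ c d → (IsEdge w v c d × ¬ SamePair c d a b) ⇔ IsEdge (x ++ (b ∷ a ∷ y)) v c d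
lemma2 n w v x y a b _ πw≡πv refl c d = mk⇔ forward backward
  where
  w′ : Word n
  w′ = x ++ b ∷ a ∷ y

  forward : IsEdge w v c d × ¬ SamePair c d a b → IsEdge w′ v c d
  forward ((c≢d , c∈w , d∈w , eq) , ¬ab) =
    c≢d , ∈-resp-↭ (++-swap-↭ x y) c∈w , ∈-resp-↭ (++-swap-↭ x y) d∈w ,
    trans (sym (π-swap ¬ab x y)) eq

  backward : IsEdge w′ v c d → IsEdge w v c d × ¬ SamePair c d a b
  backward (c≢d , c∈w′ , d∈w′ , eq) =
    (c≢d , ∈-resp-↭ (++-swap-↭ x y) c∈w′ , ∈-resp-↭ (++-swap-↭ x y) d∈w′ ,
     trans (π-swap ¬ab x y) eq) , ¬ab
    where
    open ≡-Reasoning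
    ¬ab : ¬ SamePair c d a b
    ¬ab (inj₁ (refl , refl)) = π-swap-≢ c≢d x y (trans πw≡πv (sym eq))
    ¬ab (inj₂ (refl , refl)) = π-swap-≢ (≢-sym c≢d) x y (begin
      π a b w  ≡⟨ πw≡πv ⟩
      π a b v  ≡⟨ π-comm a b v ⟩
      π b a v  ≡⟨ eq ⟨
      π b a w′ ≡⟨ π-comm b a w′ ⟩
      π a b w′ ∎)
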